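{- Let $k \leq n$ be positive integers and let $\lambda = (\lambda_1 \geq \cdots \geq \lambda_s \geq 0)$ be a partition of $k$ with $s$ (nonnegative) parts. For every $\sigma \in \mathcal{OP}_{n,\lambda}$ we have $\mathtt{code}(\sigma) \in \mathcal{C}_{n,\lambda}$.
   Context: A partition of $k$ with $s$ parts is a weakly decreasing sequence $\lambda=(\lambda_1\ge\cdots\ge\lambda_s)$ of nonnegative integers (trailing zeros allowed) summing to $k$; $\lambda'=(\lambda'_1\ge\lambda'_2\ge\cdots)$ is the conjugate partition ($\lambda'_j=\#\{i:\lambda_i\ge j\}$), and $\ell(\lambda)$ is the number of nonzero parts of $\lambda$. $\mathcal{OP}_{n,\lambda}$ is the set of sequences $\sigma=(B_1\mid\cdots\mid B_s)$ of (possibly empty) subsets of $[n]=\{1,\dots,n\}$ with $[n]=B_1\sqcup\cdots\sqcup B_s$ and $|B_i|\ge\lambda_i$ for all $i$. Container diagram: column $i$ of the container consists of $\lambda_i$ top-justified boxes (rows numbered $1,2,\dots$ from the top); the $\lambda_i$ smallest elements of $B_i$ are placed in these boxes increasing from bottom to top, i.e. the box in row $j$ ($1\le j\le\lambda_i$) of column $i$ holds the $(\lambda_i-j+1)$-th smallest element of $B_i$. The remaining $|B_i|-\lambda_i$ (largest) elements of $B_i$ are called floating (in block $i$). Row $j$ of the container contains $\lambda'_j$ entries. An element $x$ is "to the right of" $y$ if the block index of $x$ exceeds that of $y$. For $1\le i<j\le n$, $(i,j)$ is a coinversion of $\sigma$ if one of: (a) $i$ is floating, $j$ lies in a block to the right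 of $i$, and $j$ is in row $1$ (the top row) of the container; (b) $i$ is not floating, $j$ lies in a block to the right of $i$, and $i,j$ are in the same row of the container; (c) $i$ is not floating, $j$ lies in a block to the left of $i$, and $j$ is in the row directly below the row of $i$ in the container. Set $c_i=\#\{j>i:(i,j)\text{ is a coinversion}\}$ if $i$ is not floating, and $c_i=\#\{j>i:(i,j)\text{ is a coinversion}\}+(p-1)$ if $i$ is floating in block $p$. Then $\mathtt{code}(\sigma)=(c_1,\dots,c_n)$. $\mathcal{C}_{n,\lambda}$ is the set of length-$n$ sequences of nonnegative integers that are componentwise $\le$ some shuffle (order-preserving interleaving) of the sequences $(\lambda'_j-1,\lambda'_j-2,\dots,1,0)$ for $j=1,\dots,k$ (empty when $\lambda'_j=0$) together with the constant sequence $(s-1,\dots,s-1)$ of length $n-k$. -}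

module Defs where

open import Data.Nat using (ℕ; zero; suc; _+_; _∸_; _≤_; _<ᵇ_; _≡ᵇ_; _≤ᵇ_)
open import Data.Fin using (Fin; toℕ) renaming (zero to fzero; suc to fsuc; _≤_ to _≤ᶠ_)
open import Data.Bool using (Bool; true; false; if_then_else_; _∧_; _∨_; not)
open import Data.Nat.ListAction using (sum)
open import Data.List using (List; []; _∷_; map; allFin; upTo; downFrom; replicate)
open import Data.List.Relation.Binary.Pointwise using (Pointwise)
open import Data.List.Relation.Ternary.Interleaving.Propositional using (Interleaving)
open import Data.Product using (Σ; _×_)
open import Relation.Binary.PropositionalEquality using (_≡_)

count : ∀ {n} → (Fin n → Bool) → ℕ
count {zero}  p = 0
count {suc n} p = (if p fzero then 1 else 0) + count (λ i → p (fsuc i))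

IsPartition : (k s : ℕ) → (Fin s → ℕ) → Set
IsPartition k s la = (∀ (i j : Fin s) → i ≤ᶠ j → la j ≤ la i) × (sum (map la (allFin s)) ≡ k)

conj : ∀ {s} → (Fin s → ℕ) → ℕ → ℕ
conj la j = count (λ i → j ≤ᵇ la i)

-- An ordered set partition σ = (B_1 | ... | B_s) of [n] is encoded by its block-assignment
-- map f : Fin n → Fin s  (element x ∈ Fin n stands for toℕ x + 1 ∈ [n]; block index toℕ (f x) + 1),
-- i.e. B_{p+1} = f⁻¹(p).
blockSize : ∀ {n s} → (Fin n → Fin s) → Fin s → ℕ
blockSize f i = count (λ x → toℕ (f x) ≡ᵇ toℕ i)

IsOP : ∀ {n s} → (Fin s → ℕ) → (Fin n → Fin s) → Set
IsOP la f = ∀ i → la i ≤ blockSize f i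

module Code {n s : ℕ} (la : Fin s → ℕ) (f : Fin n → Fin s) where
  blk : Fin n → ℕ
  blk x = toℕ (f x)

  rank : Fin n → ℕ
  rank x = count (λ y → (toℕ y <ᵇ toℕ x) ∧ (blk y ≡ᵇ blk x))

  floating : Fin n → Bool
  floating x = la (f x) ≤ᵇ rank x

  -- row (1-based, from the top) of a non-floating element: the (r+1)-th smallest sits in row la_i - r
  row : Fin n → ℕ
  row x = la (f x) ∸ rank x

  -- (i , j) is a coinversion (conditions (a),(b),(c)); j must lie in the container
  coinv : Fin n → Fin n → Bool
  coinv i j =
    (toℕ i <ᵇ toℕ j) ∧ not (floating j) ∧
    (if floating i
      then ((blk i <ᵇ blk j) ∧ (row j ≡ᵇ 1))
      else (((blk i <ᵇ blk j) ∧ (row j ≡ᵇ row i)) ∨ ((blk j <ᵇ blk i) ∧ (row j ≡ᵇ suc (row i)))))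

  -- c_i  (floating in block p adds p - 1 = blk i)
  codeEntry : Fin n → ℕ
  codeEntry i = count (coinv i) + (if floating i then blk i else 0)

code : ∀ {n s} → (Fin s → ℕ) → (Fin n → Fin s) → List ℕ
code {n} la f = map (Code.codeEntry la f) (allFin n)

data Shuffle : List (List ℕ) → List ℕ → Set where
  shuf-[] : Shuffle [] []
  shuf-∷  : ∀ {xs xss ys zs} → Shuffle xss ys → Interleaving xs ys zs → Shuffle (xs ∷ xss) zs

codeSeqs : (n k s : ℕ) → (Fin s → ℕ) → List (List ℕ)
codeSeqs n k s la = replicate (n ∸ k) (s ∸ 1) ∷ map (λ j → downFrom (conj la (suc j))) (upTo k)

InC : (n k s : ℕ) → (Fin s → ℕ) → List ℕ → Set
InC n k s la c = Σ (List ℕ) (λ zs → Shuffle (codeSeqs n k s la) zs × Pointwise _≤_ c zs)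

module Submission where

-- Label every element x by its container row, row x = λ_{f x} ∸ rank x:
-- floating elements get label 0 and the others a row in 1..λ_{f x}.  Since
-- |B_q| ≥ λ_q, every box of the container holds exactly one element, so row
-- j ≥ 1 contains λ'_j elements and n ∸ k elements float.
--
-- It then proves a shuffle lemma for an arbitrary labelling by
-- 0..k: giving label-0 elements the value v and every other element the
-- number of later elements with its label yields a shuffle of (v,…,v) and
-- the sequences (m_j - 1, …, 1, 0), m_j = #{label j}.  For the row labelling
-- these are exactly the sequences defining C_{n,λ}, so it remains to bound
-- each code entry by its shuffle entry: a floating i has at most one
-- coinversion partner (in row 1) per block to its right, so c_i ≤ s - 1; for
-- a non-floating i in row r, block by block its partners are no more than
-- the later elements of row r (a partner in row r + 1 of a block to the left
-- is dominated by the element just above it).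

open import Defs
open import Data.Nat
  using (ℕ; zero; suc; _+_; _∸_; _≤_; _<_; _⊓_; _<ᵇ_; _≡ᵇ_; _≤ᵇ_; z≤n; s≤s; z<s; _≤?_)
open import Data.Nat.Properties
open import Data.Nat.ListAction as List using ()
open import Data.Fin using (Fin; toℕ) renaming (zero to fzero; suc to fsuc)
open import Data.Fin.Properties using (toℕ-injective; toℕ<n)
open import Data.Bool using (Bool; true; false; if_then_else_; _∧_; _∨_; not; T)
open import Data.Bool.Properties using (T-≡; T-not-≡; T-∧; T-∨)
open import Data.Empty using (⊥; ⊥-elim)
open import Data.Product using (∃; _×_; _,_; proj₁; proj₂; uncurry)
open import Data.Sum using (_⊎_; inj₁; inj₂)
open import Data.List using (List; []; _∷_; map; replicate; downFrom; applyUpTo; upTo; tabulate; allFin)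
open import Data.List.Properties using (map-cong; map-upTo; map-tabulate)
open import Data.List.Relation.Binary.Pointwise using (Pointwise; tabulate⁺)
open import Data.List.Relation.Ternary.Interleaving using ([]; _∷ˡ_; _∷ʳ_)
open import Algebra.Properties.CommutativeMonoid.Sum +-0-commutativeMonoid
  using (sum; sum-syntax; ∑-distrib-+; sum-cong-≗; sum-replicate-zero)
open import Function using (_∘_; _⇔_; mk⇔; Equivalence)
open import Relation.Binary.Definitions using (tri<; tri≈; tri>)
open import Relation.Binary.PropositionalEquality
open import Relation.Nullary using (¬_; yes; no)

open Equivalence using (to; from)

ind : Bool → ℕ
ind b = if b then 1 else 0

¬T⇒false : ∀ {b} → ¬ T b → b ≡ false
¬T⇒false {false} _ = refl
¬T⇒false {true} h = ⊥-elim (h _)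

T-if-true : ∀ {b x y} → b ≡ true → T (if b then x else y) → T x
T-if-true refl p = p

T-if-false : ∀ {b x y} → b ≡ false → T (if b then x else y) → T y
T-if-false refl p = p

ind-true : ∀ {b} → T b → ind b ≡ 1
ind-true {true} _ = refl

ind-false : ∀ {b} → ¬ T b → ind b ≡ 0
ind-false h = cong ind (¬T⇒false h)

ind-mono : ∀ {a b} → (T a → T b) → ind a ≤ ind b
ind-mono {false} _ = z≤n
ind-mono {true} {true} _ = ≤-refl
ind-mono {true} {false} h = ⊥-elim (h _)

ind≤1 : ∀ b → ind b ≤ 1
ind≤1 false = z≤n
ind≤1 true = ≤-refl

count-mono : ∀ {n} {P Q : Fin n → Bool} → (∀ x → T (P x) → T (Q x)) → count P ≤ count Q
count-mono {zero} h = z≤n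
count-mono {suc n} h = +-mono-≤ (ind-mono (h fzero)) (count-mono (h ∘ fsuc))

count-cong : ∀ {n} {P Q : Fin n → Bool} → (∀ x → T (P x) ⇔ T (Q x)) → count P ≡ count Q
count-cong h = ≤-antisym (count-mono (λ x → to (h x))) (count-mono (λ x → from (h x)))

count-none : ∀ {n} {P : Fin n → Bool} → (∀ x → ¬ T (P x)) → count P ≡ 0
count-none {zero} h = refl
count-none {suc n} h = cong₂ _+_ (ind-false (h fzero)) (count-none (h ∘ fsuc))

count-all : ∀ {n} → count {n} (λ _ → true) ≡ n
count-all {zero} = refl
count-all {suc n} = cong suc (count-all {n})

count-pos : ∀ {n} {P : Fin n → Bool} x → T (P x) → 1 ≤ count P
count-pos fzero p = ≤-trans (ind-mono (λ _ → p)) (m≤m+n _ _)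
count-pos (fsuc x) p = ≤-trans (count-pos x p) (m≤n+m _ _)

count-witness : ∀ {n} (P : Fin n → Bool) → 1 ≤ count P → ∃ λ x → T (P x)
count-witness {suc n} P h with P fzero in e
... | true = fzero , from T-≡ e
... | false = let (x , p) = count-witness (P ∘ fsuc) h in fsuc x , p

count-complement : ∀ {n} (P : Fin n → Bool) → count P + count (not ∘ P) ≡ n
count-complement {zero} P = refl
count-complement {suc n} P with P fzero
... | true = cong suc (count-complement (P ∘ fsuc))
... | false = trans (+-suc _ _) (cong suc (count-complement (P ∘ fsuc)))

count-≤-of-≤1 : ∀ {n} {P Q : Fin n → Bool} → count P ≤ 1 →
  (∀ x → T (P x) → 1 ≤ count Q) → count P ≤ count Q
count-≤-of-≤1 {P = P} le h with count P in e
... | zero = z≤n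
... | suc _ = ≤-trans le (uncurry h (count-witness P (subst (1 ≤_) (sym e) (s≤s z≤n))))

count-above : ∀ {s} b → count {s} (λ q → b <ᵇ toℕ q) ≡ s ∸ suc b
count-above {zero} b = refl
count-above {suc s} zero = count-all {s}
count-above {suc s} (suc b) = count-above {s} b

∑-mono : ∀ {s} {g h : Fin s → ℕ} → (∀ q → g q ≤ h q) → sum g ≤ sum h
∑-mono {zero} le = z≤n
∑-mono {suc s} le = +-mono-≤ (le fzero) (∑-mono (le ∘ fsuc))

∑-term : ∀ {s} (g : Fin s → ℕ) q → g q ≤ sum g
∑-term g fzero = m≤m+n _ _
∑-term g (fsuc q) = ≤-trans (∑-term (g ∘ fsuc) q) (m≤n+m _ _)

∑-ind : ∀ {s} (Q : Fin s → Bool) → ∑[ q < s ] (ind (Q q)) ≡ count Q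
∑-ind {zero} Q = refl
∑-ind {suc s} Q = cong (ind (Q fzero) +_) (∑-ind (Q ∘ fsuc))

∑-point : ∀ {s} (t : Fin s) → ∑[ q < s ] (ind (toℕ t ≡ᵇ toℕ q)) ≡ 1
∑-point {suc s} fzero = cong suc (sum-replicate-zero s)
∑-point (fsuc t) = ∑-point t

∑-list : ∀ {s} (g : Fin s → ℕ) → List.sum (map g (allFin s)) ≡ sum g
∑-list {s} g = trans (cong List.sum (map-tabulate (λ q → q) g)) (go g)
  where
  go : ∀ {s} (g : Fin s → ℕ) → List.sum (tabulate g) ≡ sum g
  go {zero} g = refl
  go {suc s} g = cong (g fzero +_) (go (g ∘ fsuc))

inFibre : ∀ {n s} → (Fin n → Fin s) → Fin s → Fin n → Bool
inFibre g q x = toℕ (g x) ≡ᵇ toℕ q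

fibre-point : ∀ {n s} {g : Fin n → Fin s} {q x} → T (inFibre g q x) → g x ≡ q
fibre-point p = toℕ-injective (≡ᵇ⇒≡ _ _ p)

count-by-fibres : ∀ {n s} (g : Fin n → Fin s) (P : Fin n → Bool) →
  count P ≡ ∑[ q < s ] (count (λ x → P x ∧ inFibre g q x))
count-by-fibres {zero} {s} g P = sym (sum-replicate-zero s)
count-by-fibres {suc n} {s} g P = begin
  ind (P fzero) + count (P ∘ fsuc)
    ≡⟨ cong₂ _+_ (split (P fzero)) (count-by-fibres (g ∘ fsuc) (P ∘ fsuc)) ⟩
  ∑[ q < s ] (ind (P fzero ∧ inFibre g q fzero))
    + ∑[ q < s ] (count (λ x → P (fsuc x) ∧ inFibre g q (fsuc x)))
    ≡⟨ sym (∑-distrib-+ (λ q → ind (P fzero ∧ inFibre g q fzero))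
                        (λ q → count (λ x → P (fsuc x) ∧ inFibre g q (fsuc x)))) ⟩
  ∑[ q < s ] (count (λ x → P x ∧ inFibre g q x)) ∎
  where
  open ≡-Reasoning
  split : ∀ b → ind b ≡ ∑[ q < s ] (ind (b ∧ inFibre g q fzero))
  split true = sym (∑-point (g fzero))
  split false = sym (sum-replicate-zero s)

count-≤-fibrewise : ∀ {n s} (g : Fin n → Fin s) {P Q : Fin n → Bool} →
  (∀ q → count (λ x → P x ∧ inFibre g q x) ≤ count (λ x → Q x ∧ inFibre g q x)) →
  count P ≤ count Q
count-≤-fibrewise {s = s} g {P} {Q} le = begin
  count P ≡⟨ count-by-fibres g P ⟩
  ∑[ q < s ] (count (λ x → P x ∧ inFibre g q x)) ≤⟨ ∑-mono le ⟩
  ∑[ q < s ] (count (λ x → Q x ∧ inFibre g q x)) ≡⟨ sym (count-by-fibres g Q) ⟩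
  count Q ∎
  where open ≤-Reasoning

count-≤-one-per-fibre : ∀ {n s} (g : Fin n → Fin s) {P : Fin n → Bool} {Q : Fin s → Bool} →
  (∀ q → count (λ x → P x ∧ inFibre g q x) ≤ 1) → (∀ x → T (P x) → T (Q (g x))) →
  count P ≤ count Q
count-≤-one-per-fibre {s = s} g {P} {Q} once onQ = begin
  count P ≡⟨ count-by-fibres g P ⟩
  ∑[ q < s ] (count (λ x → P x ∧ inFibre g q x)) ≤⟨ ∑-mono per-fibre ⟩
  ∑[ q < s ] (ind (Q q)) ≡⟨ ∑-ind Q ⟩
  count Q ∎
  where
  open ≤-Reasoning
  per-fibre : ∀ q → count (λ x → P x ∧ inFibre g q x) ≤ ind (Q q)
  per-fibre q with Q q in e
  ... | true = once q
  ... | false = ≤-reflexive (count-none λ x p →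
    let (px , fx) = to T-∧ p in subst T e (subst (T ∘ Q) (fibre-point {g = g} fx) (onQ x px)))

pos : ∀ {n} → (Fin n → Bool) → Fin n → ℕ
pos B x = count (λ y → (toℕ y <ᵇ toℕ x) ∧ B y)

pos-first : ∀ {n} (B : Fin (suc n) → Bool) → pos B fzero ≡ 0
pos-first B = count-none {P = λ y → (toℕ y <ᵇ 0) ∧ B y} (λ _ ())

pos-mono : ∀ {n} (B : Fin n → Bool) {x y} → toℕ x ≤ toℕ y → pos B x ≤ pos B y
pos-mono B {x} {y} x≤y = count-mono {P = λ z → (toℕ z <ᵇ toℕ x) ∧ B z} λ z p →
  let (z<x , bz) = to T-∧ p in from T-∧ (<⇒<ᵇ (<-≤-trans (<ᵇ⇒< _ _ z<x) x≤y) , bz)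

pos-below : ∀ {n} (B : Fin n → Bool) m → count (λ x → B x ∧ (pos B x <ᵇ m)) ≡ m ⊓ count B
pos-below {zero} B m = sym (⊓-zeroʳ m)
pos-below {suc n} B m =
  trans (cong (λ p → ind (B fzero ∧ (p <ᵇ m)) + count (λ x → B (fsuc x) ∧ (pos B (fsuc x) <ᵇ m)))
              (pos-first B))
        (step (B fzero) m)
  where
  step : ∀ b m → ind (b ∧ (0 <ᵇ m)) + count (λ x → B (fsuc x) ∧ (ind b + pos (B ∘ fsuc) x <ᵇ m))
    ≡ m ⊓ (ind b + count (B ∘ fsuc))
  step false m = pos-below (B ∘ fsuc) m
  step true zero = count-none {P = λ x → B (fsuc x) ∧ false} (λ x p → proj₂ (to T-∧ p))
  step true (suc m) = cong suc (pos-below (B ∘ fsuc) m)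

pos-exact : ∀ {n} (B : Fin n → Bool) m → count (λ x → B x ∧ (pos B x ≡ᵇ m)) ≡ ind (m <ᵇ count B)
pos-exact {zero} B m = refl
pos-exact {suc n} B m =
  trans (cong (λ p → ind (B fzero ∧ (p ≡ᵇ m)) + count (λ x → B (fsuc x) ∧ (pos B (fsuc x) ≡ᵇ m)))
              (pos-first B))
        (step (B fzero) m)
  where
  step : ∀ b m → ind (b ∧ (0 ≡ᵇ m)) + count (λ x → B (fsuc x) ∧ (ind b + pos (B ∘ fsuc) x ≡ᵇ m))
    ≡ ind (m <ᵇ ind b + count (B ∘ fsuc))
  step false m = pos-exact (B ∘ fsuc) m
  step true zero = cong suc (count-none {P = λ x → B (fsuc x) ∧ false} (λ x p → proj₂ (to T-∧ p)))
  step true (suc m) = pos-exact (B ∘ fsuc) m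

data ConsOnto (y : ℕ) : List (List ℕ) → List (List ℕ) → Set where
  here  : ∀ {xs xss} → ConsOnto y (xs ∷ xss) ((y ∷ xs) ∷ xss)
  there : ∀ {xs xss yss} → ConsOnto y xss yss → ConsOnto y (xs ∷ xss) (xs ∷ yss)

shuffle-cons : ∀ {y xss yss zs} → Shuffle xss zs → ConsOnto y xss yss → Shuffle yss (y ∷ zs)
shuffle-cons (shuf-∷ S I) here = shuf-∷ S (refl ∷ˡ I)
shuffle-cons (shuf-∷ S I) (there c) = shuf-∷ (shuffle-cons S c) (refl ∷ʳ I)

shuffle-empties : ∀ k → Shuffle (applyUpTo (λ _ → []) k) []
shuffle-empties zero = shuf-[]
shuffle-empties (suc k) = shuf-∷ (shuffle-empties k) []

labelSeqs : (k v : ℕ) → (ℕ → ℕ) → List (List ℕ)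
labelSeqs k v N = replicate (N 0) v ∷ applyUpTo (λ j → downFrom (N (suc j))) k

bump : ℕ → (ℕ → ℕ) → ℕ → ℕ
bump ℓ N c = ind (ℓ ≡ᵇ c) + N c

labelEntry : (v later ℓ : ℕ) → ℕ
labelEntry v later zero = v
labelEntry v later (suc _) = later

insert-label : ∀ {k v} (N : ℕ → ℕ) ℓ → ℓ ≤ k →
  ConsOnto (labelEntry v (N ℓ) ℓ) (labelSeqs k v N) (labelSeqs k v (bump ℓ N))
insert-label N zero _ = here
insert-label N (suc ℓ) ℓ<k = there (insert-row (N ∘ suc) ℓ ℓ<k)
  where
  insert-row : ∀ {k} (M : ℕ → ℕ) ℓ → ℓ < k →
    ConsOnto (M ℓ) (applyUpTo (downFrom ∘ M) k) (applyUpTo (downFrom ∘ bump ℓ M) k)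
  insert-row M zero (s≤s _) = here
  insert-row M (suc ℓ) (s≤s ℓ<k) = there (insert-row (M ∘ suc) ℓ ℓ<k)

labelCount : ∀ {n} → (Fin n → ℕ) → ℕ → ℕ
labelCount lab c = count (λ x → lab x ≡ᵇ c)

later : ∀ {n} → (Fin n → ℕ) → Fin n → ℕ
later lab i = count (λ x → (toℕ i <ᵇ toℕ x) ∧ (lab x ≡ᵇ lab i))

labelCode : ∀ {n} → ℕ → (Fin n → ℕ) → Fin n → ℕ
labelCode v lab i = labelEntry v (later lab i) (lab i)

shuffle-labels : ∀ {n} k v (lab : Fin n → ℕ) → (∀ i → lab i ≤ k) →
  Shuffle (labelSeqs k v (labelCount lab)) (tabulate (labelCode v lab))
shuffle-labels {zero} k v lab _ = shuf-∷ (shuffle-empties k) []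
shuffle-labels {suc n} k v lab ≤k =
  shuffle-cons (shuffle-labels k v (lab ∘ fsuc) (≤k ∘ fsuc))
               (insert-label (labelCount (lab ∘ fsuc)) (lab fzero) (≤k fzero))

∸≡suc⇒ : ∀ {L p j} → L ∸ p ≡ suc j → p ≡ L ∸ suc j × suc j ≤ L
∸≡suc⇒ {L} {p} {j} e = p≡ , subst (_≤ L) e (m∸n≤m L p)
  where
  p<L : p < L
  p<L = m∸n≢0⇒n<m (λ z → 0≢1+n (trans (sym z) e))
  p≡ : p ≡ L ∸ suc j
  p≡ = sym (trans (cong (L ∸_) (sym e)) (m∸[m∸n]≡n (<⇒≤ p<L)))

⇒∸≡suc : ∀ {L p j} → p ≡ L ∸ suc j → suc j ≤ L → L ∸ p ≡ suc j
⇒∸≡suc {L} e le = trans (cong (L ∸_) e) (m∸[m∸n]≡n le)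

module Container {n s : ℕ} (la : Fin s → ℕ) (f : Fin n → Fin s) (op : IsOP la f) where
  open Code la f public

  inBlock : Fin s → Fin n → Bool
  inBlock = inFibre f

  in-block : ∀ {q x} → T (inBlock q x) → f x ≡ q
  in-block = fibre-point {g = f}

  blk-in : ∀ {q x} → T (inBlock q x) → blk x ≡ toℕ q
  blk-in b = ≡ᵇ⇒≡ _ _ b

  row≤ : ∀ x → row x ≤ la (f x)
  row≤ x = m∸n≤m (la (f x)) (rank x)

  floating⇔row0 : ∀ x → T (floating x) ⇔ row x ≡ 0
  floating⇔row0 x = mk⇔ (λ p → m≤n⇒m∸n≡0 (≤ᵇ⇒≤ (la (f x)) (rank x) p))
                        (λ e → ≤⇒≤ᵇ (m∸n≡0⇒m≤n {la (f x)} {rank x} e))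

  nonfloating⇔ : ∀ {q x} → f x ≡ q → T (not (floating x)) ⇔ pos (inBlock q) x < la q
  nonfloating⇔ refl = mk⇔
    (λ p → ≰⇒> (λ le → subst T (to T-not-≡ p) (≤⇒≤ᵇ le)))
    (λ lt → from T-not-≡ (¬T⇒false (λ t → <⇒≱ lt (≤ᵇ⇒≤ _ _ t))))

  row-rank : ∀ {q x j} → f x ≡ q → row x ≡ suc j → pos (inBlock q) x ≡ la q ∸ suc j × suc j ≤ la q
  row-rank refl = ∸≡suc⇒

  rank-row : ∀ {q x j} → f x ≡ q → suc j ≤ la q → pos (inBlock q) x ≡ la q ∸ suc j → row x ≡ suc j
  rank-row refl le e = ⇒∸≡suc e le

  nonfloating-in-block : ∀ q → count (λ x → not (floating x) ∧ inBlock q x) ≡ la q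
  nonfloating-in-block q = begin
    count (λ x → not (floating x) ∧ inBlock q x)             ≡⟨ count-cong equiv ⟩
    count (λ x → inBlock q x ∧ (pos (inBlock q) x <ᵇ la q))  ≡⟨ pos-below (inBlock q) (la q) ⟩
    la q ⊓ blockSize f q                                     ≡⟨ m≤n⇒m⊓n≡m (op q) ⟩
    la q ∎
    where
    open ≡-Reasoning
    equiv : ∀ x → T (not (floating x) ∧ inBlock q x) ⇔ T (inBlock q x ∧ (pos (inBlock q) x <ᵇ la q))
    equiv x = mk⇔
      (λ p → let (nf , b) = to T-∧ p in from T-∧ (b , <⇒<ᵇ (to (nonfloating⇔ (in-block b)) nf)))
      (λ p → let (b , lt) = to T-∧ p in from T-∧ (from (nonfloating⇔ (in-block b)) (<ᵇ⇒< _ _ lt) , b))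

  cell-count : ∀ q j → count (λ x → (row x ≡ᵇ suc j) ∧ inBlock q x) ≡ ind (suc j ≤ᵇ la q)
  cell-count q j with suc j ≤? la q
  ... | yes le = begin
    count (λ x → (row x ≡ᵇ suc j) ∧ inBlock q x)                  ≡⟨ count-cong equiv ⟩
    count (λ x → inBlock q x ∧ (pos (inBlock q) x ≡ᵇ la q ∸ suc j)) ≡⟨ pos-exact (inBlock q) _ ⟩
    ind (la q ∸ suc j <ᵇ blockSize f q)                          ≡⟨ ind-true (<⇒<ᵇ top<size) ⟩
    1                                                            ≡⟨ sym (ind-true (≤⇒≤ᵇ le)) ⟩
    ind (suc j ≤ᵇ la q) ∎
    where
    open ≡-Reasoning
    top<size : la q ∸ suc j < blockSize f q
    top<size = <-≤-trans (∸-monoʳ-< z<s le) (op q)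
    equiv : ∀ x → T ((row x ≡ᵇ suc j) ∧ inBlock q x) ⇔
                  T (inBlock q x ∧ (pos (inBlock q) x ≡ᵇ la q ∸ suc j))
    equiv x = mk⇔
      (λ p → let (r , b) = to T-∧ p in
        from T-∧ (b , ≡⇒≡ᵇ _ _ (proj₁ (row-rank (in-block b) (≡ᵇ⇒≡ _ _ r)))))
      (λ p → let (b , r) = to T-∧ p in
        from T-∧ (≡⇒≡ᵇ _ _ (rank-row (in-block b) le (≡ᵇ⇒≡ _ _ r)) , b))
  ... | no ¬le = trans (count-none empty) (sym (ind-false (¬le ∘ ≤ᵇ⇒≤ _ _)))
    where
    empty : ∀ x → ¬ T ((row x ≡ᵇ suc j) ∧ inBlock q x)
    empty x p = let (r , b) = to T-∧ p in
      ¬le (subst (λ q → suc j ≤ la q) (in-block b) (subst (_≤ la (f x)) (≡ᵇ⇒≡ _ _ r) (row≤ x)))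

  cell-≤1 : ∀ q j → count (λ x → (row x ≡ᵇ suc j) ∧ inBlock q x) ≤ 1
  cell-≤1 q j = ≤-trans (≤-reflexive (cell-count q j)) (ind≤1 _)

  cell-occupied : ∀ q j → suc j ≤ la q → ∃ λ y → row y ≡ suc j × f y ≡ q
  cell-occupied q j le =
    let (y , p) = count-witness _ (≤-reflexive (sym (trans (cell-count q j) (ind-true (≤⇒≤ᵇ le)))))
        (r , b) = to T-∧ p
    in y , ≡ᵇ⇒≡ _ _ r , in-block b

  lower-row-smaller : ∀ {q x y r} → f x ≡ q → f y ≡ q → row x ≡ suc (suc r) → row y ≡ suc r →
    toℕ x < toℕ y
  lower-row-smaller {q} {x} {y} {r} fx fy rx ry =
    ≰⇒> λ y≤x → <⇒≱ rank-x<rank-y (pos-mono (inBlock q) y≤x)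
    where
    rank-x<rank-y : pos (inBlock q) x < pos (inBlock q) y
    rank-x<rank-y =
      let (px , le) = row-rank fx rx
          (py , _)  = row-rank fy ry
      in subst₂ _<_ (sym px) (sym py) (∸-monoʳ-< ≤-refl le)

  row-count : ∀ j → labelCount row (suc j) ≡ conj la (suc j)
  row-count j = begin
    count (λ x → row x ≡ᵇ suc j)                              ≡⟨ count-by-fibres f _ ⟩
    ∑[ q < s ] (count (λ x → (row x ≡ᵇ suc j) ∧ inBlock q x))    ≡⟨ sum-cong-≗ (λ q → cell-count q j) ⟩
    ∑[ q < s ] (ind (suc j ≤ᵇ la q))                             ≡⟨ ∑-ind (λ q → suc j ≤ᵇ la q) ⟩
    conj la (suc j) ∎
    where open ≡-Reasoning

  floating-count : labelCount row 0 + sum la ≡ n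
  floating-count = begin
    count (λ x → row x ≡ᵇ 0) + sum la
      ≡⟨ cong₂ _+_ (count-cong row0⇔) (sum-cong-≗ (sym ∘ nonfloating-in-block)) ⟩
    count floating + ∑[ q < s ] (count (λ x → not (floating x) ∧ inBlock q x))
      ≡⟨ cong (count floating +_) (sym (count-by-fibres f _)) ⟩
    count floating + count (not ∘ floating)
      ≡⟨ count-complement floating ⟩
    n ∎
    where
    open ≡-Reasoning
    row0⇔ : ∀ x → T (row x ≡ᵇ 0) ⇔ T (floating x)
    row0⇔ x = mk⇔ (λ p → from (floating⇔row0 x) (≡ᵇ⇒≡ _ _ p))
                  (λ p → ≡⇒≡ᵇ _ _ (to (floating⇔row0 x) p))

  module _ {k : ℕ} (∑la≡k : sum la ≡ k) where
    row≤k : ∀ x → row x ≤ k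
    row≤k x = ≤-trans (row≤ x) (subst (la (f x) ≤_) ∑la≡k (∑-term la (f x)))

    row-seqs : labelSeqs k (s ∸ 1) (labelCount row) ≡ codeSeqs n k s la
    row-seqs = cong₂ _∷_ (cong (λ m → replicate m (s ∸ 1)) floating≡) rows≡
      where
      open ≡-Reasoning
      floating≡ : labelCount row 0 ≡ n ∸ k
      floating≡ = begin
        labelCount row 0                ≡⟨ sym (m+n∸n≡m _ k) ⟩
        labelCount row 0 + k ∸ k        ≡⟨ cong (λ t → labelCount row 0 + t ∸ k) (sym ∑la≡k) ⟩
        labelCount row 0 + sum la ∸ k   ≡⟨ cong (_∸ k) floating-count ⟩
        n ∸ k ∎
      rows≡ : applyUpTo (λ j → downFrom (labelCount row (suc j))) k ≡
              map (λ j → downFrom (conj la (suc j))) (upTo k)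
      rows≡ = trans (sym (map-upTo _ k)) (map-cong (λ j → cong downFrom (row-count j)) (upTo k))

  coinv-split : ∀ {i x} → T (coinv i x) →
    T (toℕ i <ᵇ toℕ x) ×
    T (if floating i then (blk i <ᵇ blk x) ∧ (row x ≡ᵇ 1)
       else ((blk i <ᵇ blk x) ∧ (row x ≡ᵇ row i)) ∨ ((blk x <ᵇ blk i) ∧ (row x ≡ᵇ suc (row i))))
  coinv-split {i} {x} p =
    let (i<x , rest) = to (T-∧ {toℕ i <ᵇ toℕ x}) p in i<x , proj₂ (to (T-∧ {not (floating x)}) rest)

  floating-partner : ∀ {i x} → floating i ≡ true → T (coinv i x) → T (blk i <ᵇ blk x) × T (row x ≡ᵇ 1)
  floating-partner {i} {x} e p = to (T-∧ {blk i <ᵇ blk x}) (T-if-true e (proj₂ (coinv-split p)))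

  data Partner (i x : Fin n) : Set where
    same-row : blk i < blk x → row x ≡ row i → Partner i x
    next-row : blk x < blk i → row x ≡ suc (row i) → Partner i x

  nonfloating-partner : ∀ {i x} → floating i ≡ false → T (coinv i x) → toℕ i < toℕ x × Partner i x
  nonfloating-partner {i} {x} e p =
    let (i<x , sel) = coinv-split p
    in <ᵇ⇒< _ _ i<x , kind (to (T-∨ {(blk i <ᵇ blk x) ∧ (row x ≡ᵇ row i)}) (T-if-false e sel))
    where
    kind : T ((blk i <ᵇ blk x) ∧ (row x ≡ᵇ row i)) ⊎ T ((blk x <ᵇ blk i) ∧ (row x ≡ᵇ suc (row i))) →
      Partner i x
    kind (inj₁ q) = let (c , r) = to (T-∧ {blk i <ᵇ blk x}) q in same-row (<ᵇ⇒< _ _ c) (≡ᵇ⇒≡ _ _ r)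
    kind (inj₂ q) = let (c , r) = to (T-∧ {blk x <ᵇ blk i}) q in next-row (<ᵇ⇒< _ _ c) (≡ᵇ⇒≡ _ _ r)

  -- a floating element has c_i ≤ s - 1: at most one partner per block to its right
  floating-bound : ∀ i → row i ≡ 0 → codeEntry i ≤ s ∸ 1
  floating-bound i r0 = begin
    codeEntry i                          ≡⟨ cong (λ b → count (coinv i) + (if b then blk i else 0)) fl ⟩
    count (coinv i) + blk i              ≤⟨ +-monoˡ-≤ (blk i) partners ⟩
    count RightOf + blk i                ≡⟨ cong (_+ blk i) (count-above {s} (blk i)) ⟩
    s ∸ suc (blk i) + blk i              ≡⟨ arith (toℕ<n (f i)) ⟩
    s ∸ 1 ∎
    where
    open ≤-Reasoning
    fl : floating i ≡ true
    fl = to T-≡ (from (floating⇔row0 i) r0)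
    RightOf : Fin s → Bool
    RightOf q = blk i <ᵇ toℕ q
    partners : count (coinv i) ≤ count RightOf
    partners = count-≤-one-per-fibre f {P = coinv i} {Q = RightOf}
      (λ q → ≤-trans (count-mono {P = λ x → coinv i x ∧ inBlock q x}
                                 {Q = λ x → (row x ≡ᵇ 1) ∧ inBlock q x}
                       (λ x p → let (c , b) = to (T-∧ {coinv i x}) p in
                                from T-∧ (proj₂ (floating-partner fl c) , b)))
                     (cell-≤1 q 0))
      (λ x p → proj₁ (floating-partner fl p))
    arith : ∀ {b s} → b < s → s ∸ suc b + b ≡ s ∸ 1
    arith (s≤s b≤s) = m∸n+n≡m b≤s

  -- Partners of a non-floating i in row r + 1, compared block by block with
  -- the later elements of row r + 1
  module NonFloating (i : Fin n) (r : ℕ) (ri : row i ≡ suc r) where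
    nf : floating i ≡ false
    nf = ¬T⇒false (λ p → 0≢1+n (trans (sym (to (floating⇔row0 i) p)) ri))

    PartnerIn LaterIn : Fin s → Fin n → Bool
    PartnerIn q x = coinv i x ∧ inBlock q x
    LaterIn q x = ((toℕ i <ᵇ toℕ x) ∧ (row x ≡ᵇ row i)) ∧ inBlock q x

    partner-in : ∀ {q x} → T (PartnerIn q x) → toℕ i < toℕ x × Partner i x × T (inBlock q x)
    partner-in {q} {x} p =
      let (c , b) = to (T-∧ {coinv i x}) p
          (i<x , k) = nonfloating-partner nf c
      in i<x , k , b

    right-block : ∀ q → blk i < toℕ q → count (PartnerIn q) ≤ count (LaterIn q)
    right-block q i<q = count-mono {P = PartnerIn q} {Q = LaterIn q} (λ x p → case (partner-in p))
      where
      case : ∀ {x} → toℕ i < toℕ x × Partner i x × T (inBlock q x) → T (LaterIn q x)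
      case (i<x , same-row _ rx , b) = from T-∧ (from T-∧ (<⇒<ᵇ i<x , ≡⇒≡ᵇ _ _ rx) , b)
      case (_ , next-row x<i _ , b) = ⊥-elim (<-asym i<q (subst (_< blk i) (blk-in b) x<i))

    own-block : ∀ q → blk i ≡ toℕ q → count (PartnerIn q) ≡ 0
    own-block q i≡q = count-none {P = PartnerIn q} (λ x p → case (partner-in p))
      where
      case : ∀ {x} → toℕ i < toℕ x × Partner i x × T (inBlock q x) → ⊥
      case (_ , same-row i<x _ , b) = <-irrefl (trans i≡q (sym (blk-in b))) i<x
      case (_ , next-row x<i _ , b) = <-irrefl (trans (blk-in b) (sym i≡q)) x<i

    -- in a block to the left the only possible partner is the element of row r + 2 (case (c)),
    -- and the element just above it is a later element of row r + 1
    left-block : ∀ q → toℕ q < blk i → count (PartnerIn q) ≤ count (LaterIn q)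
    left-block q q<i = count-≤-of-≤1 {P = PartnerIn q} {Q = LaterIn q} at-most-one dominated
      where
      next : ∀ {x} → T (PartnerIn q x) → toℕ i < toℕ x × row x ≡ suc (suc r) × f x ≡ q
      next p with partner-in p
      ... | i<x , next-row _ rx , b = i<x , trans rx (cong suc ri) , in-block b
      ... | _ , same-row i<x _ , b = ⊥-elim (<-asym q<i (subst (blk i <_) (blk-in b) i<x))
      at-most-one : count (PartnerIn q) ≤ 1
      at-most-one = ≤-trans (count-mono {P = PartnerIn q} {Q = λ x → (row x ≡ᵇ suc (suc r)) ∧ inBlock q x}
        (λ x p → let (_ , rx , fx) = next p in from T-∧ (≡⇒≡ᵇ _ _ rx , ≡⇒≡ᵇ _ _ (cong toℕ fx))))
        (cell-≤1 q (suc r))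
      dominated : ∀ x → T (PartnerIn q x) → 1 ≤ count (LaterIn q)
      dominated x p =
        let (i<x , rx , fx) = next p
            (y , ry , fy) = cell-occupied q r (<⇒≤ (proj₂ (row-rank fx rx)))
            x<y = lower-row-smaller fx fy rx ry
        in count-pos {P = LaterIn q} y
             (from T-∧ (from T-∧ (<⇒<ᵇ (<-trans i<x x<y) , ≡⇒≡ᵇ _ _ (trans ry (sym ri)))
                       , ≡⇒≡ᵇ _ _ (cong toℕ fy)))

  nonfloating-bound : ∀ i r → row i ≡ suc r → codeEntry i ≤ later row i
  nonfloating-bound i r ri = begin
    codeEntry i               ≡⟨ cong (λ b → count (coinv i) + (if b then blk i else 0)) nf ⟩
    count (coinv i) + 0       ≡⟨ +-identityʳ _ ⟩
    count (coinv i)           ≤⟨ count-≤-fibrewise f per-block ⟩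
    later row i ∎
    where
    open ≤-Reasoning
    open NonFloating i r ri
    per-block : ∀ q → count (PartnerIn q) ≤ count (LaterIn q)
    per-block q with <-cmp (blk i) (toℕ q)
    ... | tri< i<q _ _ = right-block q i<q
    ... | tri≈ _ i≡q _ = ≤-trans (≤-reflexive (own-block q i≡q)) z≤n
    ... | tri> _ _ q<i = left-block q q<i

  code-bound : ∀ i → codeEntry i ≤ labelCode (s ∸ 1) row i
  code-bound i = by-row (row i) refl
    where
    by-row : ∀ r → row i ≡ r → codeEntry i ≤ labelEntry (s ∸ 1) (later row i) r
    by-row zero r0 = floating-bound i r0
    by-row (suc r) ri = nonfloating-bound i r ri

lemma3p3 : (n k s : ℕ) → 1 ≤ k → k ≤ n → (la : Fin s → ℕ) → IsPartition k s la →
    (f : Fin n → Fin s) → IsOP la f → InC n k s la (code la f)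
lemma3p3 n k s _ _ la (_ , sum≡k) f op =
  zs ,
  subst (λ xss → Shuffle xss zs) (row-seqs ∑la≡k) (shuffle-labels k (s ∸ 1) row (row≤k ∑la≡k)) ,
  subst (λ c → Pointwise _≤_ c zs) (sym (map-tabulate (λ x → x) codeEntry)) (tabulate⁺ code-bound)
  where
  open Container la f op
  ∑la≡k : sum la ≡ k
  ∑la≡k = trans (sym (∑-list la)) sum≡k
  zs : List ℕ
  zs = tabulate (labelCode (s ∸ 1) row)
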